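{- Let $P,Q$ be posets, $\mathcal{I}$ an open down-set and $\mathcal{F}$ a disjoint open up-set of $\mathrm{Pro}(P,Q)$. Then $[\mathcal{I},\mathcal{F}]$ is a Dedekind cut if and only if the gap $\mathrm{Pro}(P,Q)\setminus(\mathcal{I}\cup\mathcal{F})$ contains neither large nor small profunctors.
   Context: $\widehat{Q}$ is the set of down-sets of $Q$ ordered by inclusion. A profunctor $f:P\to Q$ is an order-preserving map $f:P\to\widehat{Q}$; $\mathrm{Pro}(P,Q)$ is ordered pointwise by inclusion. $f$ is large if $\{p: f(p)\neq Q\}$ is finite, small if $\bigcup_p f(p)$ is finite. The topology on $\mathrm{Pro}(P,Q)$ has as basis the sets $U(g,h)=\{f: g\le f\le h\}$ with $g$ small and $h$ large. An open set is regular if it equals the interior of its closure. A Dedekind cut is a pair $[\mathcal{I},\mathcal{F}]$ where $\mathcal{I}$ is a regular open down-set and $\mathcal{F}$ is the complement of the closure of $\mathcal{I}$. -}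

module Defs where

open import Level using (0ℓ) renaming (suc to lsuc)
open import Data.Product using (Σ; ∃; ∃-syntax; _×_; _,_)
open import Data.List using (List)
open import Data.List.Relation.Unary.Any using (Any)
open import Relation.Nullary using (¬_)
open import Relation.Binary.Bundles using (Poset)
open import Function.Bundles using (_⇔_)

module _ (P Q : Poset 0ℓ 0ℓ 0ℓ) where
  private
    module P = Poset P
    module Q = Poset Q

  record DownSet : Set₁ where
    field
      mem  : Q.Carrier → Set
      down : ∀ {x y} → x Q.≤ y → mem y → mem x
  open DownSet public

  _⊆ᵈ_ : DownSet → DownSet → Set
  A ⊆ᵈ B = ∀ q → mem A q → mem B q

  -- profunctor P ⇸ Q : order-preserving map P → Q̂
  record Pro : Set₁ where
    field
      app  : P.Carrier → DownSet
      mono : ∀ {p p'} → p P.≤ p' → app p ⊆ᵈ app p'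
  open Pro public

  _≤ᴾ_ : Pro → Pro → Set
  g ≤ᴾ f = ∀ p → app g p ⊆ᵈ app f p

  NotFull : DownSet → Set
  NotFull A = ¬ (∀ q → mem A q)

  Large : Pro → Set
  Large f = ∃[ ps ] (∀ p → NotFull (app f p) → Any (p P.≈_) ps)

  Small : Pro → Set
  Small f = ∃[ qs ] (∀ p q → mem (app f p) q → Any (q Q.≈_) qs)

  PSet : Set₂
  PSet = Pro → Set₁

  U : Pro → Pro → PSet
  U g h f = Lift' (g ≤ᴾ f × f ≤ᴾ h)
    where
    open import Level using (Lift)
    Lift' : Set → Set₁
    Lift' A = Lift (lsuc 0ℓ) A

  InBasicInside : PSet → Pro → Set₁
  InBasicInside A f =
    ∃[ g ] ∃[ h ] (Small g × Large h × g ≤ᴾ f × f ≤ᴾ h × (∀ f' → U g h f' → A f'))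

  IsOpen : PSet → Set₁
  IsOpen A = ∀ f → A f → InBasicInside A f

  interior : PSet → PSet
  interior A = InBasicInside A

  closure : PSet → PSet
  closure A f = ∀ g h → Small g → Large h → g ≤ᴾ f → f ≤ᴾ h →
                ∃[ f' ] (U g h f' × A f')

  _≐_ : PSet → PSet → Set₁
  A ≐ B = ∀ f → A f ⇔ B f

  IsRegularOpen : PSet → Set₁
  IsRegularOpen A = IsOpen A × (A ≐ interior (closure A))

  IsDownSet : PSet → Set₁
  IsDownSet A = ∀ f g → g ≤ᴾ f → A f → A g

  IsUpSet : PSet → Set₁
  IsUpSet A = ∀ f g → f ≤ᴾ g → A f → A g

  complement : PSet → PSet
  complement A f = ¬ A f

  IsDedekindCut : PSet → PSet → Set₁
  IsDedekindCut I F = IsRegularOpen I × IsDownSet I × (F ≐ complement (closure I))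

{-# OPTIONS --safe #-}
module Submission where

-- Profunctors form a lattice with a large top and a small bottom, and the
-- closure of a down-set is again a down-set. Hence a large profunctor in the
-- closure of I lies in the interior of that closure, and a small one lies in
-- I itself; this shows that gap elements of a Dedekind cut are neither large
-- nor small. Conversely, a point outside the closure of I sits above a small
-- point outside I, and a point of the interior of the closure sits below a
-- large point of the closure; if the gap has no small or large points these
-- witnesses fall into F resp. I, which is what regularity and
-- F = complement (closure I) require.

open import Defs
open import Data.Empty using (⊥; ⊥-elim)
open import Data.Unit using (⊤; tt)
open import Level using (0ℓ; lift) renaming (suc to lsuc)
open import Data.Product using (_×_; _,_; ∃-syntax; proj₁; proj₂)
open import Data.Sum using (_⊎_; inj₁; inj₂)
open import Data.List using ([])
open import Relation.Nullary using (¬_; yes; no)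
open import Relation.Binary.Bundles using (Poset)
open import Function.Bundles using (_⇔_; mk⇔; Equivalence)
open import Axiom.ExcludedMiddle using (ExcludedMiddle)

module ProfunctorTopology (P Q : Poset 0ℓ 0ℓ 0ℓ) where

  private
    _≤_ : Pro P Q → Pro P Q → Set
    _≤_ = _≤ᴾ_ P Q

  ≤ᴾ-refl : ∀ f → f ≤ f
  ≤ᴾ-refl f p q x = x

  ≤ᴾ-trans : ∀ f g h → f ≤ g → g ≤ h → f ≤ h
  ≤ᴾ-trans f g h f≤g g≤h p q x = g≤h p q (f≤g p q x)

  ⊤ᴾ : Pro P Q
  ⊤ᴾ = record
    { app  = λ _ → record { mem = λ _ → ⊤ ; down = λ _ _ → tt }
    ; mono = λ _ _ _ → tt }

  ⊥ᴾ : Pro P Q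
  ⊥ᴾ = record
    { app  = λ _ → record { mem = λ _ → ⊥ ; down = λ _ () }
    ; mono = λ _ _ () }

  _∨ᴾ_ : Pro P Q → Pro P Q → Pro P Q
  f ∨ᴾ g = record
    { app  = λ p → record
        { mem  = λ q → mem (app f p) q ⊎ mem (app g p) q
        ; down = λ { q≤q' (inj₁ x) → inj₁ (down (app f p) q≤q' x)
                   ; q≤q' (inj₂ y) → inj₂ (down (app g p) q≤q' y) } }
    ; mono = λ { p≤p' q (inj₁ x) → inj₁ (mono f p≤p' q x)
               ; p≤p' q (inj₂ y) → inj₂ (mono g p≤p' q y) } }

  _∧ᴾ_ : Pro P Q → Pro P Q → Pro P Q
  f ∧ᴾ g = record
    { app  = λ p → record
        { mem  = λ q → mem (app f p) q × mem (app g p) q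
        ; down = λ q≤q' (x , y) → down (app f p) q≤q' x , down (app g p) q≤q' y }
    ; mono = λ p≤p' q (x , y) → mono f p≤p' q x , mono g p≤p' q y }

  ⊤ᴾ-large : Large P Q ⊤ᴾ
  ⊤ᴾ-large = [] , λ p notFull → ⊥-elim (notFull (λ _ → tt))

  ⊥ᴾ-small : Small P Q ⊥ᴾ
  ⊥ᴾ-small = [] , λ p q ()

  ∨ᴾ-largeˡ : ∀ h f → Large P Q h → Large P Q (h ∨ᴾ f)
  ∨ᴾ-largeˡ h f (ps , cover) = ps , λ p notFull → cover p (λ full → notFull (λ q → inj₁ (full q)))

  ⊆-closure : ∀ {A : PSet P Q} {f} → A f → closure P Q A f
  ⊆-closure {f = f} Af g h _ _ g≤f f≤h = f , lift (g≤f , f≤h) , Af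

  open⇒⊆interior : ∀ {A B : PSet P Q} → IsOpen P Q A → (∀ f → A f → B f) →
                   ∀ f → A f → interior P Q B f
  open⇒⊆interior openA A⊆B f Af with openA f Af
  ... | g , h , small , large , g≤f , f≤h , U⊆A =
    g , h , small , large , g≤f , f≤h , λ f' f'∈U → A⊆B f' (U⊆A f' f'∈U)

  -- A neighbourhood U(g,h) of f'' ≤ f is met by enlarging it to U(g, h ∨ f) around f
  -- and cutting the witness found there back down by meeting it with h.
  closure-downSet : ∀ {A : PSet P Q} → IsDownSet P Q A → IsDownSet P Q (closure P Q A)
  closure-downSet downA f f'' f''≤f clf g h small large g≤f'' f''≤h
    with clf g (h ∨ᴾ f) small (∨ᴾ-largeˡ h f large) (≤ᴾ-trans g f'' f g≤f'' f''≤f) (λ p q → inj₂)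
  ... | f' , lift (g≤f' , _) , Af' =
    f' ∧ᴾ h , lift (g≤f'∧h , (λ p q → proj₂)) , downA f' (f' ∧ᴾ h) (λ p q → proj₁) Af'
    where
    g≤f'∧h : g ≤ (f' ∧ᴾ h)
    g≤f'∧h p q x = g≤f' p q x , f''≤h p q (g≤f'' p q x)

  downSet-large⇒interior : ∀ {A : PSet P Q} {f} → IsDownSet P Q A → Large P Q f → A f → interior P Q A f
  downSet-large⇒interior {f = f} downA large Af =
    ⊥ᴾ , f , ⊥ᴾ-small , large , (λ p q ()) , ≤ᴾ-refl f ,
    λ { f' (lift (_ , f'≤f)) → downA f f' f'≤f Af }

  closure-downSet-small : ∀ {A : PSet P Q} {f} → IsDownSet P Q A → Small P Q f → closure P Q A f → A f
  closure-downSet-small {f = f} downA small clf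
    with clf f ⊤ᴾ small ⊤ᴾ-large (≤ᴾ-refl f) (λ p q _ → tt)
  ... | f' , lift (f≤f' , _) , Af' = downA f' f f≤f' Af'

  interior⇒large-above : ∀ {A : PSet P Q} {f} → interior P Q A f → ∃[ h ] (Large P Q h × f ≤ h × A h)
  interior⇒large-above {f = f} (g , h , _ , large , g≤f , f≤h , U⊆A) =
    h , large , f≤h , U⊆A h (lift (≤ᴾ-trans g f h g≤f f≤h , ≤ᴾ-refl h))

  open-disjoint⇒¬closure : ∀ {A F : PSet P Q} → IsOpen P Q F → (∀ f → A f → F f → ⊥) →
                           ∀ f → F f → ¬ closure P Q A f
  open-disjoint⇒¬closure openF disjoint f Ff clf with openF f Ff
  ... | g , h , small , large , g≤f , f≤h , U⊆F with clf g h small large g≤f f≤h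
  ... | f' , f'∈U , Af' = disjoint f' Af' (U⊆F f' f'∈U)

  -- Classically, if every small g ≤ f were in A, then every basic neighbourhood
  -- U(g,h) of f would meet A at g.
  ¬closure⇒small-below-outside : ExcludedMiddle (lsuc 0ℓ) → ∀ {A : PSet P Q} {f} → ¬ closure P Q A f →
                                 ∃[ g ] (Small P Q g × g ≤ f × ¬ A g)
  ¬closure⇒small-below-outside em {A} {f} ¬clf with em {∃[ g ] (Small P Q g × g ≤ f × ¬ A g)}
  ... | yes witness = witness
  ... | no none = ⊥-elim (¬clf meets)
    where
    meets : closure P Q A f
    meets g h small _ g≤f f≤h with em {A g}
    ... | yes Ag = g , lift (≤ᴾ-refl g , ≤ᴾ-trans g f h g≤f f≤h) , Ag
    ... | no ¬Ag = ⊥-elim (none (g , small , g≤f , ¬Ag))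

corollary5p9 : ExcludedMiddle (lsuc 0ℓ) → (P Q : Poset 0ℓ 0ℓ 0ℓ) → (I F : PSet P Q) →
    IsOpen P Q I → IsDownSet P Q I → IsOpen P Q F → IsUpSet P Q F →
    (∀ f → I f → F f → ⊥) →
    IsDedekindCut P Q I F ⇔
      (∀ f → ¬ I f → ¬ F f → ¬ Large P Q f × ¬ Small P Q f)
corollary5p9 em P Q I F openI downI openF upF disjoint = mk⇔ gap-empty cut
  where
  open ProfunctorTopology P Q
  F⊆¬closureI : ∀ f → F f → ¬ closure P Q I f
  F⊆¬closureI = open-disjoint⇒¬closure openF disjoint

  gap-empty : IsDedekindCut P Q I F → ∀ f → ¬ I f → ¬ F f → ¬ Large P Q f × ¬ Small P Q f
  gap-empty ((_ , regular) , _ , F≐¬closureI) f ¬If ¬Ff = not-large , not-small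
    where
    closureI-f : closure P Q I f
    closureI-f with em {closure P Q I f}
    ... | yes clf = clf
    ... | no ¬clf = ⊥-elim (¬Ff (Equivalence.from (F≐¬closureI f) ¬clf))
    not-large : ¬ Large P Q f
    not-large large = ¬If (Equivalence.from (regular f)
      (downSet-large⇒interior {closure P Q I} {f} (closure-downSet {I} downI) large closureI-f))
    not-small : ¬ Small P Q f
    not-small small = ¬If (closure-downSet-small downI small closureI-f)

  cut : (∀ f → ¬ I f → ¬ F f → ¬ Large P Q f × ¬ Small P Q f) → IsDedekindCut P Q I F
  cut gap = (openI , regular) , downI , λ f → mk⇔ (F⊆¬closureI f) (¬closureI⊆F f)
    where
    ¬closureI⊆F : ∀ f → ¬ closure P Q I f → F f
    ¬closureI⊆F f ¬clf with ¬closure⇒small-below-outside em {I} {f} ¬clf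
    ... | g , small , g≤f , ¬Ig with em {F g}
    ... | yes Fg = upF g f g≤f Fg
    ... | no ¬Fg = ⊥-elim (proj₂ (gap g ¬Ig ¬Fg) small)
    interior-closureI⊆I : ∀ f → interior P Q (closure P Q I) f → I f
    interior-closureI⊆I f intf with interior⇒large-above {closure P Q I} {f} intf
    ... | h , large , f≤h , clh with em {I h}
    ... | yes Ih = downI h f f≤h Ih
    ... | no ¬Ih = ⊥-elim (proj₁ (gap h ¬Ih (λ Fh → F⊆¬closureI h Fh clh)) large)
    regular : ∀ f → I f ⇔ interior P Q (closure P Q I) f
    regular f = mk⇔ (open⇒⊆interior openI (λ _ → ⊆-closure) f) (interior-closureI⊆I f)
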